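{- Let $\Gamma$ be a finite, simple, connected, undirected tetravalent graph with an odd number of vertices, and let $X\le\mathrm{Aut}\,\Gamma$ be transitive on the vertices of $\Gamma$. Suppose further that $|X|$ is odd. Then $X$ acts regularly on the vertex set of $\Gamma$.
   Context: Tetravalent means every vertex has valency 4. A permutation group is regular if it is transitive and the stabiliser of a point is trivial. -}

module Defs where

open import Data.Nat using (ℕ)
open import Data.Bool using (Bool; true; false; T)
open import Data.Fin using (Fin)
open import Data.List using (List; length; filter; allFin)
open import Data.List.Relation.Unary.Any using (Any)
open import Data.List.Relation.Unary.AllPairs using (AllPairs)
open import Data.Fin.Permutation using (Permutation′; _⟨$⟩ʳ_; _≈_; id; flip; _∘ₚ_)
open import Data.Product using (_×_; ∃)
open import Relation.Nullary using (¬_)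
open import Relation.Nullary.Decidable using (does)
open import Data.Bool.Properties using (T?)
open import Relation.Binary.PropositionalEquality using (_≡_)
open import Relation.Binary.Construct.Closure.ReflexiveTransitive using (Star)

record Graph (n : ℕ) : Set where
  field
    adj : Fin n → Fin n → Bool

module _ {n : ℕ} (Γ : Graph n) where
  open Graph Γ

  Simple : Set
  Simple = (∀ v → adj v v ≡ false) × (∀ u v → adj u v ≡ adj v u)

  neighbours : Fin n → List (Fin n)
  neighbours v = filter (λ w → T? (adj v w)) (allFin n)

  degree : Fin n → ℕ
  degree v = length (neighbours v)

  Tetravalent : Set
  Tetravalent = ∀ v → degree v ≡ 4

  Connected : Set
  Connected = ∀ u v → Star (λ x y → T (adj x y)) u v

  IsAut : Permutation′ n → Set
  IsAut σ = ∀ u v → adj (σ ⟨$⟩ʳ u) (σ ⟨$⟩ʳ v) ≡ adj u v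

-- A finite set of permutations, given as a list; membership up to extensional equality.
_∈ₚ_ : {n : ℕ} → Permutation′ n → List (Permutation′ n) → Set
σ ∈ₚ X = Any (λ τ → σ ≈ τ) X

-- The list has no repetitions (pairwise extensionally distinct), so |X| = length X.
NoDupₚ : {n : ℕ} → List (Permutation′ n) → Set
NoDupₚ X = AllPairs (λ σ τ → ¬ (σ ≈ τ)) X

IsSubgroup : {n : ℕ} → List (Permutation′ n) → Set
IsSubgroup X = (id ∈ₚ X)
             × (∀ σ τ → σ ∈ₚ X → τ ∈ₚ X → (σ ∘ₚ τ) ∈ₚ X)
             × (∀ σ → σ ∈ₚ X → flip σ ∈ₚ X)

IsAutSubgroup : {n : ℕ} → Graph n → List (Permutation′ n) → Set
IsAutSubgroup Γ X = NoDupₚ X × IsSubgroup X × (∀ σ → σ ∈ₚ X → IsAut Γ σ)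

Transitive : {n : ℕ} → List (Permutation′ n) → Set
Transitive {n} X = ∀ (u v : Fin n) → ∃ λ σ → σ ∈ₚ X × σ ⟨$⟩ʳ u ≡ v

StabilisersTrivial : {n : ℕ} → List (Permutation′ n) → Set
StabilisersTrivial {n} X = ∀ σ → σ ∈ₚ X → ∀ (v : Fin n) → σ ⟨$⟩ʳ v ≡ v → σ ≈ id

Regular : {n : ℕ} → List (Permutation′ n) → Set
Regular X = Transitive X × StabilisersTrivial X

-- An element of odd order cannot swap two points (an even power of it would be an
-- involution, impossible in a group of odd order), so the orbital digraph of an arc
-- (v, w) under X is antisymmetric.  If some σ ∈ Xᵥ moved w, then w, σw, σ²w would be
-- three distinct out-neighbours of v in it; with two in-neighbours v would have five
-- neighbours, so every vertex has in-valency at most 1.  By counting, the out-valency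
-- is then at most 1 as well, forcing σw = w.  Hence Xᵥ fixes the neighbours of every
-- vertex it fixes, and by connectivity it is trivial.
module Submission where

open import Defs
open import Level using (0ℓ)
open import Data.Nat using (ℕ; zero; suc; _+_; _∸_; _≤_; _<_; z<s)
open import Data.Nat.Properties
  using (+-suc; m<n⇒m<1+n; m<n⇒0<n∸m; m<m+n; m∸n+n≡m; <⇒≤; n<1+n; ≤-reflexive; 1+n≰n)
open import Data.Nat.Divisibility using (_∣_; _∣0; ∣-refl; ∣m∣n⇒∣m+n)
open import Data.Nat.Induction using (<-wellFounded)
open import Induction.WellFounded using (Acc; acc)
open import Data.Bool using (T)
open import Data.Fin using (Fin; toℕ; _≟_; punchOut)
open import Data.Fin.Properties using (pigeonhole; injective⇒≤; punchOut-injective; all?; any?)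
open import Data.Fin.Permutation
  using (Permutation′; _⟨$⟩ʳ_; _⟨$⟩ˡ_; id; flip; _∘ₚ_; inverseˡ; inverseʳ)
open import Data.List using (List; []; _∷_; length)
open import Data.List.Properties using (length-removeAt′)
open import Data.List.Relation.Unary.Any using (here; there; index)
open import Data.List.Relation.Unary.AllPairs using ([]; _∷_)
import Data.List.Relation.Unary.All.Properties as All
import Data.List.Membership.Setoid as SetoidMembership
import Data.List.Membership.Setoid.Properties as SetoidMembershipₚ
import Data.List.Relation.Unary.Unique.Setoid as SetoidUnique
import Data.List.Relation.Unary.Unique.Setoid.Properties as SetoidUniqueₚ
open import Data.List.Membership.Propositional.Properties using (∈-filter⁺; ∈-allFin)
open import Data.Vec using (Vec; []; _∷_; lookup)
open import Data.Vec.Relation.Unary.All as VecAll using ([]; _∷_)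
import Data.Vec.Relation.Unary.All.Properties as VecAllₚ
open import Data.Vec.Relation.Unary.Unique.Propositional as VecUnique using ([]; _∷_)
open import Data.Vec.Relation.Unary.Unique.Propositional.Properties using (lookup-injective)
open import Data.Bool.Properties using (T?)
open import Data.Product using (_×_; _,_; ∃; proj₁; proj₂)
open import Function using (_∘′_)
open import Function.Bundles using (Injection)
open import Function.Definitions using (Injective)
open import Function.Properties.Inverse using (↔⇒↣)
open import Relation.Binary.Bundles using (Setoid)
open import Relation.Binary.PropositionalEquality using (_≡_; _≢_)
import Relation.Binary.PropositionalEquality as ≡
open import Relation.Binary.Construct.Closure.ReflexiveTransitive using (Star; ε; _◅_)
open import Relation.Nullary using (¬_; Dec; yes; no; contradiction)

module _ {a ℓ} (S : Setoid a ℓ) where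

  open Setoid S renaming (Carrier to A)
  open SetoidMembership S using (_∈_; _∉_; _─_)
  open SetoidMembershipₚ using (∈-resp-≈)
  open SetoidUnique S using (Unique)
  open SetoidUniqueₚ using (Unique[x∷xs]⇒x∉xs)

  ∈-─⁻ : ∀ {x y xs} (p : x ∈ xs) → y ∈ xs ─ p → y ∈ xs
  ∈-─⁻ (here _)  q         = there q
  ∈-─⁻ (there p) (here q)  = here q
  ∈-─⁻ (there p) (there q) = there (∈-─⁻ p q)

  ∈-─⁺ : ∀ {x y xs} (p : x ∈ xs) → y ∈ xs → ¬ y ≈ x → y ∈ xs ─ p
  ∈-─⁺ (here x≈z) (here y≈z) y≉x = contradiction (trans y≈z (sym x≈z)) y≉x
  ∈-─⁺ (here _)   (there q)  _   = q
  ∈-─⁺ (there p)  (here q)   _   = here q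
  ∈-─⁺ (there p)  (there q)  y≉x = there (∈-─⁺ p q y≉x)

  ∉-─ : ∀ {x xs} → Unique xs → (p : x ∈ xs) → x ∉ xs ─ p
  ∉-─ uniq@(_ ∷ _) (here x≈z) q =
    Unique[x∷xs]⇒x∉xs S uniq (∈-resp-≈ S x≈z q)
  ∉-─ uniq@(_ ∷ _) (there p) (here x≈z) =
    Unique[x∷xs]⇒x∉xs S uniq (∈-resp-≈ S x≈z p)
  ∉-─ (_ ∷ uniq) (there p) (there q) = ∉-─ uniq p q

  Unique-─ : ∀ {x xs} → Unique xs → (p : x ∈ xs) → Unique (xs ─ p)
  Unique-─ (_ ∷ uniq)   (here _)  = uniq
  Unique-─ (z≉ ∷ uniq) (there p) = All.─⁺ p z≉ ∷ Unique-─ uniq p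

  module _ (f : A → A) (f-cong : ∀ {x y} → x ≈ y → f x ≈ f y)
           (f-involutive : ∀ x → f (f x) ≈ x) (f-fixedPointFree : ∀ x → ¬ f x ≈ x) where

    -- x and f x are removed together, and what is left is again closed under f.
    closed⇒even-length : ∀ {xs} → Unique xs → (∀ {x} → x ∈ xs → f x ∈ xs) → 2 ∣ length xs
    closed⇒even-length {xs} = go xs (<-wellFounded (length xs))
      where
      go : ∀ xs → Acc _<_ (length xs) → Unique xs → (∀ {x} → x ∈ xs → f x ∈ xs) →
           2 ∣ length xs
      go []       _         _                  _      = 2 ∣0
      go (x ∷ ys) (acc rec) uniq@(_ ∷ uniq-ys) closed with closed (here refl)
      ... | here fx≈x = contradiction fx≈x (f-fixedPointFree x)
      ... | there p   = ≡.subst (λ k → 2 ∣ suc k) (≡.sym |ys|)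
            (∣m∣n⇒∣m+n ∣-refl (go (ys ─ p) (rec (m<n⇒m<1+n (≤-reflexive (≡.sym |ys|))))
                                  (Unique-─ uniq-ys p) closed-─))
        where
        |ys| : length ys ≡ suc (length (ys ─ p))
        |ys| = length-removeAt′ ys (index p)

        closed-─ : ∀ {z} → z ∈ ys ─ p → f z ∈ ys ─ p
        closed-─ {z} z∈ with closed (there (∈-─⁻ p z∈))
        ... | here fz≈x   = contradiction
          (∈-resp-≈ S (trans (sym (f-involutive z)) (f-cong fz≈x)) z∈) (∉-─ uniq-ys p)
        ... | there fz∈ys = ∈-─⁺ p fz∈ys λ fz≈fx →
          Unique[x∷xs]⇒x∉xs S uniq
            (∈-resp-≈ S (trans (sym (f-involutive z)) (trans (f-cong fz≈fx) (f-involutive x)))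
                      (∈-─⁻ p z∈))

open import Data.Fin.Permutation using (_≈_)
open ≡ using (refl; sym; trans; cong; subst; setoid; module ≡-Reasoning)

⟨$⟩ʳ-injective : ∀ {n} (π : Permutation′ n) → Injective _≡_ _≡_ (π ⟨$⟩ʳ_)
⟨$⟩ʳ-injective π = Injection.injective (↔⇒↣ π)

permutationSetoid : ℕ → Setoid 0ℓ 0ℓ
permutationSetoid n = record
  { Carrier       = Permutation′ n
  ; _≈_           = _≈_
  ; isEquivalence = record
    { refl  = λ _ → refl
    ; sym   = λ π≈ρ i → sym (π≈ρ i)
    ; trans = λ π≈ρ ρ≈τ i → trans (π≈ρ i) (ρ≈τ i)
    }
  }

infix 4 _≈?_

_≈?_ : ∀ {n} (π ρ : Permutation′ n) → Dec (π ≈ ρ)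
π ≈? ρ = all? λ i → π ⟨$⟩ʳ i ≟ ρ ⟨$⟩ʳ i

infixr 10 _^_

_^_ : ∀ {n} → Permutation′ n → ℕ → Permutation′ n
σ ^ zero  = id
σ ^ suc k = σ ∘ₚ σ ^ k

^-+ : ∀ {n} (σ : Permutation′ n) j k → σ ^ (j + k) ≈ σ ^ j ∘ₚ σ ^ k
^-+ σ zero    k x = refl
^-+ σ (suc j) k x = ^-+ σ j k (σ ⟨$⟩ʳ x)

module _ {n} {σ : Permutation′ n} {a b : Fin n}
         (σa≡b : σ ⟨$⟩ʳ a ≡ b) (σb≡a : σ ⟨$⟩ʳ b ≡ a) (a≢b : a ≢ b) where

  swap-period-even : ∀ m → (σ ^ m) ⟨$⟩ʳ a ≡ a → ∃ λ k → m ≡ k + k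
  swap-period-even zero          _    = 0 , refl
  swap-period-even (suc zero)    σa≡a = contradiction (trans (sym σa≡a) σa≡b) a≢b
  swap-period-even (suc (suc m)) fix with swap-period-even m
    (trans (cong ((σ ^ m) ⟨$⟩ʳ_) (sym (trans (cong (σ ⟨$⟩ʳ_) σa≡b) σb≡a))) fix)
  ... | k , refl = suc k , cong suc (sym (+-suc k k))

module _ {n} (X : List (Permutation′ n)) (subgroup : IsSubgroup X) where

  open SetoidMembership (permutationSetoid n) using (_∈_)
  open SetoidUnique (permutationSetoid n) using (Unique)

  id∈X : id ∈ X
  id∈X = proj₁ subgroup

  ∘-∈ : ∀ σ τ → σ ∈ X → τ ∈ X → σ ∘ₚ τ ∈ X
  ∘-∈ = proj₁ (proj₂ subgroup)

  flip-∈ : ∀ σ → σ ∈ X → flip σ ∈ X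
  flip-∈ = proj₂ (proj₂ subgroup)

  ^-∈ : ∀ σ → σ ∈ X → ∀ k → σ ^ k ∈ X
  ^-∈ σ σ∈X zero    = id∈X
  ^-∈ σ σ∈X (suc k) = ∘-∈ σ (σ ^ k) σ∈X (^-∈ σ σ∈X k)

  -- Two of σ⁰, …, σ^|X| coincide as elements of the list X.
  finite-order : ∀ σ → σ ∈ X → ∃ λ m → 0 < m × σ ^ m ≈ id
  finite-order σ σ∈X
    with i , j , i<j , same-index ← pigeonhole (n<1+n (length X)) (λ k → index (^-∈ σ σ∈X (toℕ k)))
    = toℕ j ∸ toℕ i , m<n⇒0<n∸m i<j , period
    where
    σⁱ≈σʲ : σ ^ toℕ i ≈ σ ^ toℕ j
    σⁱ≈σʲ = SetoidMembershipₚ.index-injective (permutationSetoid n) {σ ^ toℕ i} {σ ^ toℕ j}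
              (^-∈ σ σ∈X (toℕ i)) (^-∈ σ σ∈X (toℕ j)) same-index

    period : σ ^ (toℕ j ∸ toℕ i) ≈ id
    period x = ⟨$⟩ʳ-injective (σ ^ toℕ i) (begin
      (σ ^ toℕ i) ⟨$⟩ʳ ((σ ^ (toℕ j ∸ toℕ i)) ⟨$⟩ʳ x) ≡⟨ ^-+ σ (toℕ j ∸ toℕ i) (toℕ i) x ⟨
      (σ ^ (toℕ j ∸ toℕ i + toℕ i)) ⟨$⟩ʳ x            ≡⟨ cong (λ k → (σ ^ k) ⟨$⟩ʳ x) (m∸n+n≡m (<⇒≤ i<j)) ⟩
      (σ ^ toℕ j) ⟨$⟩ʳ x                               ≡⟨ σⁱ≈σʲ x ⟨
      (σ ^ toℕ i) ⟨$⟩ʳ x                               ∎)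
      where open ≡-Reasoning

  involution⇒even-order : Unique X → ∀ t → t ∈ X → ¬ t ≈ id → t ∘ₚ t ≈ id → 2 ∣ length X
  involution⇒even-order uniq t t∈X t≉id tt≈id =
    closed⇒even-length (permutationSetoid n) (_∘ₚ t)
      (λ g≈h x → cong (t ⟨$⟩ʳ_) (g≈h x))
      (λ g x → tt≈id (g ⟨$⟩ʳ x))
      (λ g gt≈g → t≉id λ i → trans (cong (t ⟨$⟩ʳ_) (sym (inverseʳ g)))
                                   (trans (gt≈g (g ⟨$⟩ˡ i)) (inverseʳ g)))
      uniq (λ {g} g∈X → ∘-∈ g t g∈X t∈X)

  module _ (σ : Permutation′ n) {a b : Fin n} (σ∈X : σ ∈ X)
           (σa≡b : σ ⟨$⟩ʳ a ≡ b) (σb≡a : σ ⟨$⟩ʳ b ≡ a) (a≢b : a ≢ b) where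

    -- If σ^(2k) = id then σ^k is an involution unless σ^k = id, in which case halve again.
    swap⇒involution : ∃ λ t → t ∈ X × ¬ t ≈ id × t ∘ₚ t ≈ id
    swap⇒involution with m , 0<m , σᵐ≈id ← finite-order σ σ∈X = go m (<-wellFounded m) 0<m σᵐ≈id
      where
      go : ∀ m → Acc _<_ m → 0 < m → σ ^ m ≈ id → ∃ λ t → t ∈ X × ¬ t ≈ id × t ∘ₚ t ≈ id
      go m (acc rec) 0<m σᵐ≈id with swap-period-even σa≡b σb≡a a≢b m (σᵐ≈id a)
      go _ _         () _      | zero , refl
      go _ (acc rec) _  σᵐ≈id  | suc k , refl with σ ^ suc k ≈? id
      ... | no  σᵏ≉id = σ ^ suc k , ^-∈ σ σ∈X (suc k) , σᵏ≉id
                      , λ x → trans (sym (^-+ σ (suc k) (suc k) x)) (σᵐ≈id x)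
      ... | yes σᵏ≈id = go (suc k) (rec (m<m+n (suc k) z<s)) z<s σᵏ≈id

  odd-order⇒swap-free : Unique X → ¬ 2 ∣ length X →
                        ∀ σ {a b} → σ ∈ X → σ ⟨$⟩ʳ a ≡ b → σ ⟨$⟩ʳ b ≡ a → a ≡ b
  odd-order⇒swap-free uniq odd σ {a} {b} σ∈X σa≡b σb≡a with a ≟ b
  ... | yes a≡b = a≡b
  ... | no  a≢b with t , t∈X , t≉id , tt≈id ← swap⇒involution σ σ∈X σa≡b σb≡a a≢b
    = contradiction (involution⇒even-order uniq t t∈X t≉id tt≈id) odd

injective⇒surjective : ∀ {n} {f : Fin n → Fin n} → Injective _≡_ _≡_ f → ∀ y → ∃ λ x → f x ≡ y
injective⇒surjective {suc n} {f} f-inj y with any? (λ x → f x ≟ y)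
... | yes hit = hit
... | no  miss = contradiction (injective⇒≤ punchOut∘f-injective) 1+n≰n
  where
  punchOut∘f : Fin (suc n) → Fin n
  punchOut∘f x = punchOut {i = y} λ y≡fx → miss (x , sym y≡fx)

  punchOut∘f-injective : Injective _≡_ _≡_ punchOut∘f
  punchOut∘f-injective = f-inj ∘′ punchOut-injective {i = y} _ _

module _ {n} (Γ : Graph n) where

  open Graph Γ
  open SetoidMembership (setoid (Fin n)) using (_∈_)
  open SetoidMembershipₚ using (index-injective)

  unique-neighbours⇒≤degree : ∀ {k v} (us : Vec (Fin n) k) → VecUnique.Unique us →
                              VecAll.All (λ u → T (adj v u)) us → k ≤ degree Γ v
  unique-neighbours⇒≤degree {v = v} us uniq adjacent =
    injective⇒≤ {f = λ i → index (∈nbrs i)} λ {i} {j} same-index →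
      lookup-injective uniq i j (index-injective (setoid (Fin n)) (∈nbrs i) (∈nbrs j) same-index)
    where
    ∈nbrs : ∀ i → lookup us i ∈ neighbours Γ v
    ∈nbrs i = ∈-filter⁺ (λ u → T? (adj v u)) (∈-allFin (lookup us i))
                        (VecAllₚ.lookup⁺ adjacent i)

module _ {n} (Γ : Graph n) (X : List (Permutation′ n))
         (simple : Simple Γ) (tetravalent : Tetravalent Γ)
         (aut : ∀ σ → σ ∈ₚ X → IsAut Γ σ) (subgroup : IsSubgroup X) (transitive : Transitive X)
         (swap-free : ∀ σ {a b} → σ ∈ₚ X → σ ⟨$⟩ʳ a ≡ b → σ ⟨$⟩ʳ b ≡ a → a ≡ b) where

  open Graph Γ

  adjacent⇒≢ : ∀ {x y} → T (adj x y) → x ≢ y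
  adjacent⇒≢ {x} x~x refl = subst T (proj₁ simple x) x~x

  module _ {v w : Fin n} (v~w : T (adj v w)) where

    Arc : Fin n → Fin n → Set
    Arc x y = ∃ λ g → g ∈ₚ X × g ⟨$⟩ʳ v ≡ x × g ⟨$⟩ʳ w ≡ y

    Arc-base : Arc v w
    Arc-base = id , id∈X X subgroup , refl , refl

    Arc⇒adjacent : ∀ {x y} → Arc x y → T (adj x y)
    Arc⇒adjacent (g , g∈X , refl , refl) = subst T (sym (aut g g∈X v w)) v~w

    Arc-map : ∀ g → g ∈ₚ X → ∀ {x y} → Arc x y → Arc (g ⟨$⟩ʳ x) (g ⟨$⟩ʳ y)
    Arc-map g g∈X (h , h∈X , refl , refl) = h ∘ₚ g , ∘-∈ X subgroup h g h∈X g∈X , refl , refl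

    -- The element g ∘ h⁻¹ would swap x and y.
    Arc-asymmetric : ∀ {x y} → Arc x y → ¬ Arc y x
    Arc-asymmetric x→y@(h , h∈X , refl , refl) (g , g∈X , gv≡y , gw≡x) =
      adjacent⇒≢ (Arc⇒adjacent x→y)
        (swap-free (flip h ∘ₚ g) k∈X (trans (cong (g ⟨$⟩ʳ_) (inverseˡ h)) gv≡y)
                                     (trans (cong (g ⟨$⟩ʳ_) (inverseˡ h)) gw≡x))
      where
      k∈X : (flip h ∘ₚ g) ∈ₚ X
      k∈X = ∘-∈ X subgroup (flip h) g (flip-∈ X subgroup h h∈X) g∈X

    AtMostOneInArc : Fin n → Set
    AtMostOneInArc y = ∀ {x₁ x₂} → Arc x₁ y → Arc x₂ y → x₁ ≡ x₂

    -- Two in-neighbours and three out-neighbours would be five neighbours of v.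
    three-out-arcs⇒AtMostOneInArc : ∀ {o₁ o₂ o₃} → Arc v o₁ → Arc v o₂ → Arc v o₃ →
                                    o₁ ≢ o₂ → o₁ ≢ o₃ → o₂ ≢ o₃ → AtMostOneInArc v
    three-out-arcs⇒AtMostOneInArc {o₁} {o₂} {o₃} r₁ r₂ r₃ o₁≢o₂ o₁≢o₃ o₂≢o₃ {a₁} {a₂} s₁ s₂
      with a₁ ≟ a₂
    ... | yes a₁≡a₂ = a₁≡a₂
    ... | no  a₁≢a₂ = contradiction
      (subst (5 ≤_) (tetravalent v) (unique-neighbours⇒≤degree Γ us distinct adjacent)) 1+n≰n
      where
      us : Vec (Fin n) 5
      us = a₁ ∷ a₂ ∷ o₁ ∷ o₂ ∷ o₃ ∷ []

      in≢out : ∀ {a o} → Arc a v → Arc v o → a ≢ o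
      in≢out a→v v→o refl = Arc-asymmetric a→v v→o

      distinct : VecUnique.Unique us
      distinct = (a₁≢a₂ ∷ in≢out s₁ r₁ ∷ in≢out s₁ r₂ ∷ in≢out s₁ r₃ ∷ [])
               ∷ (in≢out s₂ r₁ ∷ in≢out s₂ r₂ ∷ in≢out s₂ r₃ ∷ [])
               ∷ (o₁≢o₂ ∷ o₁≢o₃ ∷ [])
               ∷ (o₂≢o₃ ∷ [])
               ∷ []
               ∷ []

      in-adjacent : ∀ {a} → Arc a v → T (adj v a)
      in-adjacent s = subst T (proj₂ simple _ _) (Arc⇒adjacent s)

      adjacent : VecAll.All (λ u → T (adj v u)) us
      adjacent = in-adjacent s₁ ∷ in-adjacent s₂
               ∷ Arc⇒adjacent r₁ ∷ Arc⇒adjacent r₂ ∷ Arc⇒adjacent r₃ ∷ []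

    AtMostOneInArc-everywhere : AtMostOneInArc v → ∀ y → AtMostOneInArc y
    AtMostOneInArc-everywhere at-v y r₁ r₂ with k , k∈X , refl ← transitive v y
      = ⟨$⟩ʳ-injective (flip k) (at-v (pull-back r₁) (pull-back r₂))
      where
      pull-back : ∀ {x} → Arc x (k ⟨$⟩ʳ v) → Arc (flip k ⟨$⟩ʳ x) v
      pull-back r = subst (Arc _) (inverseˡ k) (Arc-map (flip k) (flip-∈ X subgroup k k∈X) r)

    -- Every vertex x has an out-arc to out x; these are all distinct, hence exhaust Fin n.
    out-arc-unique : (∀ y → AtMostOneInArc y) → ∀ {x y₁ y₂} → Arc x y₁ → Arc x y₂ → y₁ ≡ y₂
    out-arc-unique in-unique {x} r₁ r₂ = trans (≡out r₁) (sym (≡out r₂))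
      where
      out : Fin n → Fin n
      out z = proj₁ (transitive v z) ⟨$⟩ʳ w

      Arc-out : ∀ z → Arc z (out z)
      Arc-out z = let g , g∈X , gv≡z = transitive v z in g , g∈X , gv≡z , refl

      out-injective : Injective _≡_ _≡_ out
      out-injective {z₁} {z₂} eq = in-unique (out z₂) (subst (Arc z₁) eq (Arc-out z₁)) (Arc-out z₂)

      ≡out : ∀ {y} → Arc x y → y ≡ out x
      ≡out {y} r with z , refl ← injective⇒surjective out-injective y
        = cong out (in-unique (out z) (Arc-out z) r)

    stabiliser-fixes-neighbour : ∀ σ → σ ∈ₚ X → σ ⟨$⟩ʳ v ≡ v → σ ⟨$⟩ʳ w ≡ w
    stabiliser-fixes-neighbour σ σ∈X σv≡v with σ ⟨$⟩ʳ w ≟ w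
    ... | yes σw≡w = σw≡w
    ... | no  σw≢w = contradiction
      (out-arc-unique (AtMostOneInArc-everywhere
          (three-out-arcs⇒AtMostOneInArc Arc-base v→σw v→σσw w≢σw w≢σσw σw≢σσw)) Arc-base v→σw)
      w≢σw
      where
      Arc-σ : ∀ {y} → Arc v y → Arc v (σ ⟨$⟩ʳ y)
      Arc-σ r = subst (λ x → Arc x _) σv≡v (Arc-map σ σ∈X r)

      v→σw  = Arc-σ Arc-base
      v→σσw = Arc-σ v→σw

      w≢σw : w ≢ σ ⟨$⟩ʳ w
      w≢σw w≡σw = σw≢w (sym w≡σw)

      σw≢σσw : σ ⟨$⟩ʳ w ≢ σ ⟨$⟩ʳ (σ ⟨$⟩ʳ w)
      σw≢σσw eq = w≢σw (⟨$⟩ʳ-injective σ eq)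

      w≢σσw : w ≢ σ ⟨$⟩ʳ (σ ⟨$⟩ʳ w)
      w≢σσw eq = w≢σw (swap-free σ σ∈X refl (sym eq))

  stabiliser-fixes-reachable : ∀ σ → σ ∈ₚ X → ∀ {v u} → σ ⟨$⟩ʳ v ≡ v →
                               Star (λ x y → T (adj x y)) v u → σ ⟨$⟩ʳ u ≡ u
  stabiliser-fixes-reachable σ σ∈X σv≡v ε           = σv≡v
  stabiliser-fixes-reachable σ σ∈X σv≡v (v~y ◅ y⇝u) =
    stabiliser-fixes-reachable σ σ∈X (stabiliser-fixes-neighbour v~y σ σ∈X σv≡v) y⇝u

lemma3p1 : (n : ℕ) (Γ : Graph n) (X : List (Permutation′ n)) →
    Simple Γ → Connected Γ → Tetravalent Γ → ¬ (2 ∣ n) →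
    IsAutSubgroup Γ X → Transitive X → ¬ (2 ∣ length X) →
    Regular X
lemma3p1 n Γ X simple connected tetravalent _ (uniq , subgroup , aut) transitive odd =
  transitive , λ σ σ∈X v σv≡v u →
    stabiliser-fixes-reachable Γ X simple tetravalent aut subgroup transitive
      (odd-order⇒swap-free X subgroup uniq odd) σ σ∈X σv≡v (connected v u)
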